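{- Consider the following non-adaptive randomized algorithm, given $V$ (with $|V|=n$), CC-oracle access to a hidden graph $G$ on $V$, and the maximum degree $\Delta$ of $G$: initialize $H$ to the complete graph on $V$; then $t=\mathcal{O}(\Delta^2\log n)$ times (with a suitable constant), independently sample $Q\subseteq V$ by including each vertex independently with probability $1/(\Delta+1)$, query $\mathcal{C}=\mathrm{CC}(Q)$, and for all $u,v\in Q$ lying in different components of $\mathcal{C}$ remove the edge $uv$ from $H$; finally output $H$. This algorithm solves the Graph Reconstruction problem with $\mathcal{O}(\Delta^2 \log n)$ CC queries, and its output equals $G$ with high probability.
   Context: Graph Reconstruction (GR): an unknown ("hidden") simple undirected graph $G=(V,E)$ on a known vertex set $V$ with $|V|=n$ is to be determined. A CC oracle, on query $S\subseteq V$, returns the partition of $S$ into the vertex sets of the connected components of the induced subgraph $G[S]$. A non-adaptive algorithm fixes all its (possibly random) queries before seeing answers. "With high probability" means with probability tending to $1$ as $n\to\infty$. -}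

module Defs where

open import Data.Bool using (Bool; true; false; _∧_; _∨_; not; if_then_else_)
open import Data.Nat as ℕ using (ℕ; zero; suc)
open import Data.Fin using (Fin; _≟_)
open import Data.List using (List; []; _∷_; foldr; map; concatMap)
open import Data.List.Base using (allFin)
import Data.List as L
import Data.Bool.ListAction as BL
open import Data.Vec as V using (Vec; []; _∷_; lookup)
open import Data.Integer using (+_)
open import Data.Rational using (ℚ; _/_; 0ℚ; 1ℚ; _+_; _*_; _-_)
open import Relation.Nullary.Decidable using (⌊_⌋)
open import Relation.Binary.PropositionalEquality using (_≡_)

Graph : ℕ → Set
Graph n = Fin n → Fin n → Bool

IsSimple : ∀ {n} → Graph n → Set
IsSimple {n} G = (∀ u v → G u v ≡ G v u) × (∀ u → G u u ≡ false)
  where open import Data.Product using (_×_)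

anyFin : ∀ n → (Fin n → Bool) → Bool
anyFin n f = BL.any f (allFin n)

allFin? : ∀ n → (Fin n → Bool) → Bool
allFin? n f = BL.all f (allFin n)

degree : ∀ {n} → Graph n → Fin n → ℕ
degree {n} G v = L.length (L.filterᵇ (G v) (allFin n))

maxDegree : ∀ {n} → Graph n → ℕ
maxDegree {n} G = foldr ℕ._⊔_ 0 (map (degree G) (allFin n))

Subset : ℕ → Set
Subset n = Vec Bool n

_∈ᵇ_ : ∀ {n} → Fin n → Subset n → Bool
u ∈ᵇ Q = lookup Q u

-- walkWithin G Q k u v = true iff u ∈ Q, v ∈ Q and there is a walk
-- from u to v of length ≤ k all of whose vertices lie in Q
-- (i.e. a walk in the induced subgraph G[Q]).
walkWithin : ∀ {n} → Graph n → Subset n → ℕ → Fin n → Fin n → Bool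
walkWithin G Q zero u v = (u ∈ᵇ Q) ∧ ⌊ u ≟ v ⌋
walkWithin {n} G Q (suc k) u v =
  walkWithin G Q k u v ∨
  anyFin n (λ w → walkWithin G Q k u w ∧ G w v ∧ (v ∈ᵇ Q))

-- u and v lie in the same connected component of G[Q], i.e. in the same
-- block of the partition CC(Q) returned by the oracle.  (Walks of length
-- ≤ n suffice, as any path has fewer than n edges.)
sameComponent : ∀ {n} → Graph n → Subset n → Fin n → Fin n → Bool
sameComponent {n} G Q u v = walkWithin G Q n u v

separates : ∀ {n} → Graph n → Subset n → Fin n → Fin n → Bool
separates G Q u v = (u ∈ᵇ Q) ∧ (v ∈ᵇ Q) ∧ not (sameComponent G Q u v)

output : ∀ {n t} → Graph n → Vec (Subset n) t → Graph n
output G Qs u v = not ⌊ u ≟ v ⌋ ∧ not (V.foldr _ (λ Q b → separates G Q u v ∨ b) false Qs)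

graphEq : ∀ {n} → Graph n → Graph n → Bool
graphEq {n} H G = allFin? n (λ u → allFin? n (λ v → eqB (H u v) (G u v)))
  where
  eqB : Bool → Bool → Bool
  eqB true b = b
  eqB false b = not b

-- Probability space: each Q_i includes each vertex independently with
-- probability p = 1/(Δ+1); the t samples are independent.

allSubsets : ∀ n → List (Subset n)
allSubsets zero = [] ∷ []
allSubsets (suc n) = concatMap (λ Q → (true ∷ Q) ∷ (false ∷ Q) ∷ []) (allSubsets n)

allSeqs : ∀ n t → List (Vec (Subset n) t)
allSeqs n zero = [] ∷ []
allSeqs n (suc t) = concatMap (λ Q → map (Q ∷_) (allSeqs n t)) (allSubsets n)

subsetWeight : ℚ → ∀ {n} → Subset n → ℚ
subsetWeight p [] = 1ℚ
subsetWeight p (true ∷ Q) = p * subsetWeight p Q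
subsetWeight p (false ∷ Q) = (1ℚ - p) * subsetWeight p Q

seqWeight : ℚ → ∀ {n t} → Vec (Subset n) t → ℚ
seqWeight p Qs = V.foldr _ (λ Q w → subsetWeight p Q * w) 1ℚ Qs

sumℚ : List ℚ → ℚ
sumℚ = foldr _+_ 0ℚ

successProb : ∀ {n} → Graph n → (Δ t : ℕ) → ℚ
successProb {n} G Δ t =
  sumℚ (map (λ Qs → if graphEq (output G Qs) G then seqWeight p Qs else 0ℚ)
            (allSeqs n t))
  where
  p : ℚ
  p = + 1 / suc Δ

{-# OPTIONS --safe #-}
module Submission where

-- Let p = 1/(Δ+1) and let uv be a non-edge of G. A sample Q containing u and v but no neighbour
-- of u makes u an isolated vertex of G[Q], so Q separates u from v and uv is deleted; this happens
-- with probability p²(1-p)^deg(u) ≥ p²/4. Edges of G are never deleted, so the output differs from G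
-- only if some non-edge survives all t samples, which by the union bound has probability at most
-- n²(1 - p²/4)^t. Bernoulli's inequality gives (1 - p²/4)^(4(Δ+1)²) ≤ 1/2, so for
-- t = 12(Δ+1)²⌈log₂ n⌉ the failure probability is at most n² / n³ = 1/n.

open import Defs

module _ where
  open import Algebra.Bundles using (Semiring; CommutativeRing)
  open import Data.Bool.Base using (Bool; true; false; T; not; _∧_; _∨_; if_then_else_)
  open import Data.Bool.ListAction using (all; any)
  open import Data.Bool.Properties using (T-∧; T-∨)
  open import Data.Empty using (⊥-elim)
  open import Data.Fin.Base using (Fin; zero; suc)
  open import Data.Fin.Properties using (_≟_)
  open import Data.Integer.Base as ℤ using (+[1+_]; -[1+_])
  import Data.Integer.Properties as ℤₚ
  import Data.Integer.Tactic.RingSolver as ℤ-Solver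
  open import Data.List.Base using (List; []; _∷_; _++_; map; concatMap; foldr; length; allFin; tabulate; filterᵇ)
  open import Data.List.Membership.Propositional using (_∈_; find; lose)
  open import Data.List.Membership.Propositional.Properties using (∈-allFin; ∈-map⁺)
  import Data.List.Properties as Listₚ
  open import Data.List.Relation.Unary.All.Properties using (¬All⇒Any¬; all⁻)
  open import Data.List.Relation.Unary.Any using (Any; here; there; satisfied)
  open import Data.List.Relation.Unary.Any.Properties using (any⁺; any⁻)
  open import Data.Maybe.Base using (Maybe; just; nothing)
  open import Data.Nat.Base as ℕ using (ℕ; zero; suc; z≤n; s≤s; ⌈_/2⌉)
  open import Data.Nat.Coprimality using (1-coprimeTo)
  open import Data.Nat.Induction using (<-wellFounded)
  open import Data.Nat.Logarithm using (⌈log₂_⌉)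
  open import Data.Nat.Logarithm.Core using (⌈log2⌉)
  import Data.Nat.Properties as ℕₚ
  import Data.Nat.Tactic.RingSolver as ℕ-Solver
  open import Data.Product.Base using (∃; _,_; proj₁; proj₂)
  open import Data.Rational.Base as ℚ using (ℚ; mkℚ; 0ℚ; 1ℚ; ½; _+_; _*_; _-_; -_; _≤_; _<_; _/_; *≤*; *<*)
  open import Data.Rational.Literals using (fromℤ)
  import Data.Rational.Properties as ℚₚ
  import Data.Rational.Unnormalised.Base as ℚᵘ
  import Data.Rational.Unnormalised.Properties as ℚᵘₚ
  open import Data.Sum.Base using (inj₁; inj₂; [_,_])
  open import Data.Unit.Base using (tt)
  open import Data.Vec.Base as V using (Vec; []; _∷_)
  open import Function.Base using (_∘_)
  open import Function.Bundles using (Equivalence)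
  open import Induction.WellFounded using (Acc; acc)
  open import Level using (0ℓ)
  open import Relation.Binary.PropositionalEquality
    using (_≡_; _≢_; refl; sym; trans; cong; cong₂; subst; subst₂; module ≡-Reasoning)
  open import Relation.Nullary.Decidable
    using (Dec; yes; no; ⌊_⌋; T?; dec⇒maybe; toWitness; fromWitness; toWitnessFalse; fromWitnessFalse)
  open import Relation.Nullary.Negation using (¬_)
  open import Tactic.RingSolver using (solve-∀)
  open import Tactic.RingSolver.Core.AlmostCommutativeRing using (AlmostCommutativeRing; fromCommutativeRing)

  open Equivalence using (to; from)

  ℚ-semiring : Semiring 0ℓ 0ℓ
  ℚ-semiring = CommutativeRing.semiring ℚₚ.+-*-commutativeRing

  open import Algebra.Properties.Semiring.Exp ℚ-semiring using (_^_; ^-homo-*; ^-assocʳ)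
  open import Algebra.Properties.Semiring.Mult ℚ-semiring using (_×_; ×-homo-+; ×-assocˡ; ×-assoc-*; ×-comm-*)
  open import Algebra.Properties.CommutativeMonoid.Sum ℚₚ.*-1-commutativeMonoid using ()
    renaming (sum to ∏; ∑-distrib-+ to ∏-distrib-*; sum-cong-≗ to ∏-cong; sum-replicate-zero to ∏-replicate-1)

  private variable
    m n t : ℕ
    a b c d x y ε : ℚ
    A B I : Set

  -- Rational arithmetic

  ℚ-ring : AlmostCommutativeRing 0ℓ 0ℓ
  ℚ-ring = fromCommutativeRing ℚₚ.+-*-commutativeRing (dec⇒maybe ∘ (0ℚ ℚₚ.≟_))

  0≤1 : 0ℚ ≤ 1ℚ
  0≤1 = ℚₚ.nonNegative⁻¹ 1ℚ

  *-nonNeg : 0ℚ ≤ a → 0ℚ ≤ b → 0ℚ ≤ a * b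
  *-nonNeg {a} {b} 0≤a 0≤b =
    ℚₚ.nonNegative⁻¹ _ {{ℚₚ.nonNeg*nonNeg⇒nonNeg a {{ℚ.nonNegative 0≤a}} b {{ℚ.nonNegative 0≤b}}}}

  *-monoˡ-≤ : 0ℚ ≤ c → a ≤ b → c * a ≤ c * b
  *-monoˡ-≤ {c} 0≤c = ℚₚ.*-monoˡ-≤-nonNeg c {{ℚ.nonNegative 0≤c}}

  *-mono-≤ : 0ℚ ≤ a → 0ℚ ≤ c → a ≤ b → c ≤ d → a * c ≤ b * d
  *-mono-≤ {a} {c} {b} {d} 0≤a 0≤c a≤b c≤d = begin
    a * c ≤⟨ ℚₚ.*-monoʳ-≤-nonNeg c {{ℚ.nonNegative 0≤c}} a≤b ⟩
    b * c ≤⟨ *-monoˡ-≤ (ℚₚ.≤-trans 0≤a a≤b) c≤d ⟩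
    b * d ∎
    where open ℚₚ.≤-Reasoning

  a≤a+b : 0ℚ ≤ b → a ≤ a + b
  a≤a+b {b} {a} 0≤b = begin
    a      ≡⟨ sym (ℚₚ.+-identityʳ a) ⟩
    a + 0ℚ ≤⟨ ℚₚ.+-monoʳ-≤ a 0≤b ⟩
    a + b  ∎
    where open ℚₚ.≤-Reasoning

  a-b≤a : 0ℚ ≤ b → a - b ≤ a
  a-b≤a {b} {a} 0≤b = begin
    a - b  ≤⟨ ℚₚ.+-monoʳ-≤ a (ℚₚ.neg-antimono-≤ 0≤b) ⟩
    a - 0ℚ ≡⟨ ℚₚ.+-identityʳ a ⟩
    a      ∎
    where open ℚₚ.≤-Reasoning

  a≤b⇒0≤b-a : a ≤ b → 0ℚ ≤ b - a
  a≤b⇒0≤b-a {a} {b} a≤b = begin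
    0ℚ    ≡⟨ sym (ℚₚ.+-inverseʳ a) ⟩
    a - a ≤⟨ ℚₚ.+-monoˡ-≤ (- a) a≤b ⟩
    b - a ∎
    where open ℚₚ.≤-Reasoning

  1-x≤1-y : y ≤ x → 1ℚ - x ≤ 1ℚ - y
  1-x≤1-y y≤x = ℚₚ.+-monoʳ-≤ 1ℚ (ℚₚ.neg-antimono-≤ y≤x)

  1^n≡1 : ∀ n → 1ℚ ^ n ≡ 1ℚ
  1^n≡1 zero = refl
  1^n≡1 (suc n) = cong (1ℚ *_) (1^n≡1 n)

  ^-nonNeg : ∀ n → 0ℚ ≤ x → 0ℚ ≤ x ^ n
  ^-nonNeg zero _ = 0≤1
  ^-nonNeg (suc n) 0≤x = *-nonNeg 0≤x (^-nonNeg n 0≤x)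

  ^-monoˡ-≤ : ∀ n → 0ℚ ≤ x → x ≤ y → x ^ n ≤ y ^ n
  ^-monoˡ-≤ zero _ _ = ℚₚ.≤-refl
  ^-monoˡ-≤ (suc n) 0≤x x≤y = *-mono-≤ 0≤x (^-nonNeg n 0≤x) x≤y (^-monoˡ-≤ n 0≤x x≤y)

  ^-antimonoʳ-≤ : 0ℚ ≤ x → x ≤ 1ℚ → m ℕ.≤ n → x ^ n ≤ x ^ m
  ^-antimonoʳ-≤ {x} {n = n} 0≤x x≤1 z≤n = begin
    x ^ n  ≤⟨ ^-monoˡ-≤ n 0≤x x≤1 ⟩
    1ℚ ^ n ≡⟨ 1^n≡1 n ⟩
    1ℚ     ∎
    where open ℚₚ.≤-Reasoning
  ^-antimonoʳ-≤ 0≤x x≤1 (s≤s m≤n) = *-monoˡ-≤ 0≤x (^-antimonoʳ-≤ 0≤x x≤1 m≤n)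

  ×-nonNeg : ∀ n → 0ℚ ≤ x → 0ℚ ≤ n × x
  ×-nonNeg zero _ = ℚₚ.≤-refl
  ×-nonNeg (suc n) 0≤x = ℚₚ.+-mono-≤ 0≤x (×-nonNeg n 0≤x)

  ×-monoˡ-≤ : 0ℚ ≤ x → m ℕ.≤ n → m × x ≤ n × x
  ×-monoˡ-≤ {n = n} 0≤x z≤n = ×-nonNeg n 0≤x
  ×-monoˡ-≤ {x} 0≤x (s≤s m≤n) = ℚₚ.+-monoʳ-≤ x (×-monoˡ-≤ 0≤x m≤n)

  ×-monoʳ-≤ : ∀ n → x ≤ y → n × x ≤ n × y
  ×-monoʳ-≤ zero _ = ℚₚ.≤-refl
  ×-monoʳ-≤ (suc n) x≤y = ℚₚ.+-mono-≤ x≤y (×-monoʳ-≤ n x≤y)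

  bernoulli : ∀ n → 0ℚ ≤ x → x ≤ 1ℚ → 1ℚ - n × x ≤ (1ℚ - x) ^ n
  bernoulli zero _ _ = ℚₚ.≤-refl
  bernoulli {x} (suc n) 0≤x x≤1 = begin
    1ℚ - (x + n × x)               ≤⟨ a≤a+b (*-nonNeg (×-nonNeg n 0≤x) 0≤x) ⟩
    1ℚ - (x + n × x) + n × x * x   ≡⟨ expand x (n × x) ⟩
    (1ℚ - x) * (1ℚ - n × x)        ≤⟨ *-monoˡ-≤ (a≤b⇒0≤b-a x≤1) (bernoulli n 0≤x x≤1) ⟩
    (1ℚ - x) * (1ℚ - x) ^ n        ∎
    where
    open ℚₚ.≤-Reasoning
    expand : ∀ x a → 1ℚ - (x + a) + a * x ≡ (1ℚ - x) * (1ℚ - a)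
    expand = solve-∀ ℚ-ring

  [1-x]^n*[1+n×x]≤1 : ∀ n → 0ℚ ≤ x → x ≤ 1ℚ → (1ℚ - x) ^ n * (1ℚ + n × x) ≤ 1ℚ
  [1-x]^n*[1+n×x]≤1 zero _ _ = ℚₚ.≤-refl
  [1-x]^n*[1+n×x]≤1 {x} (suc n) 0≤x x≤1 = begin
    (1ℚ - x) * P * (1ℚ + (x + n × x))         ≡⟨ expand x (n × x) P ⟩
    P * (1ℚ + n × x) - P * ((x + n × x) * x)  ≤⟨ a-b≤a (*-nonNeg 0≤P (*-nonNeg (×-nonNeg (suc n) 0≤x) 0≤x)) ⟩
    P * (1ℚ + n × x)                          ≤⟨ [1-x]^n*[1+n×x]≤1 n 0≤x x≤1 ⟩
    1ℚ                                        ∎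
    where
    open ℚₚ.≤-Reasoning
    P = (1ℚ - x) ^ n
    0≤P : 0ℚ ≤ P
    0≤P = ^-nonNeg n (a≤b⇒0≤b-a x≤1)
    expand : ∀ x a P → (1ℚ - x) * P * (1ℚ + (x + a)) ≡ P * (1ℚ + a) - P * ((x + a) * x)
    expand = solve-∀ ℚ-ring

  x≤1⇒x^n≤1 : ∀ n → 0ℚ ≤ x → x ≤ 1ℚ → x ^ n ≤ 1ℚ
  x≤1⇒x^n≤1 {x} n 0≤x x≤1 = begin
    x ^ n  ≤⟨ ^-monoˡ-≤ n 0≤x x≤1 ⟩
    1ℚ ^ n ≡⟨ 1^n≡1 n ⟩
    1ℚ     ∎
    where open ℚₚ.≤-Reasoning

  n×x≡[n×1]*x : ∀ n x → n × x ≡ (n × 1ℚ) * x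
  n×x≡[n×1]*x n x = sym (trans (×-assoc-* n 1ℚ x) (cong (n ×_) (ℚₚ.*-identityˡ x)))

  x≤n×x : 0ℚ ≤ x → 1 ℕ.≤ n → x ≤ n × x
  x≤n×x {x} 0≤x 1≤n = begin
    x      ≡⟨ sym (ℚₚ.+-identityʳ x) ⟩
    1 × x  ≤⟨ ×-monoˡ-≤ 0≤x 1≤n ⟩
    _      ∎
    where open ℚₚ.≤-Reasoning

  ×-distrib-^ : ∀ m k → (m ℕ.^ k) × (x ^ k) ≡ (m × x) ^ k
  ×-distrib-^ m zero = refl
  ×-distrib-^ {x} m (suc k) = begin
    (m ℕ.* m ℕ.^ k) × (x * x ^ k)   ≡⟨ sym (×-assocˡ _ m (m ℕ.^ k)) ⟩
    m × ((m ℕ.^ k) × (x * x ^ k))     ≡⟨ cong (m ×_) (sym (×-comm-* (m ℕ.^ k) x (x ^ k))) ⟩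
    m × (x * ((m ℕ.^ k) × x ^ k))     ≡⟨ sym (×-assoc-* m x _) ⟩
    (m × x) * ((m ℕ.^ k) × x ^ k)     ≡⟨ cong ((m × x) *_) (×-distrib-^ m k) ⟩
    (m × x) * (m × x) ^ k           ∎
    where open ≡-Reasoning

  ×1≡fromℤ : ∀ n → n × 1ℚ ≡ fromℤ (ℤ.+ n)
  ×1≡fromℤ zero = refl
  ×1≡fromℤ (suc n) = trans (cong (1ℚ +_) (×1≡fromℤ n)) (ℚₚ.toℚᵘ-injective step)
    where
    identity : ∀ z → (ℤ.1ℤ ℤ.* ℤ.1ℤ ℤ.+ z ℤ.* ℤ.1ℤ) ℤ.* ℤ.1ℤ ≡
                     (ℤ.1ℤ ℤ.+ z) ℤ.* (ℤ.1ℤ ℤ.* ℤ.1ℤ)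
    identity = ℤ-Solver.solve-∀
    step : ℚ.toℚᵘ (1ℚ + fromℤ (ℤ.+ n)) ℚᵘ.≃ ℚ.toℚᵘ (fromℤ (ℤ.+ suc n))
    step = ℚᵘₚ.≃-trans (ℚₚ.toℚᵘ-homo-+ 1ℚ (fromℤ (ℤ.+ n))) (ℚᵘ.*≡* (identity (ℤ.+ n)))

  -- Estimates for p = 1/(Δ+1)

  1/suc : ℕ → ℚ
  1/suc Δ = ℤ.+ 1 / suc Δ

  suc×1/suc≡1 : ∀ Δ → suc Δ × 1/suc Δ ≡ 1ℚ
  suc×1/suc≡1 Δ = begin
    suc Δ × 1/suc Δ                              ≡⟨ n×x≡[n×1]*x (suc Δ) (1/suc Δ) ⟩
    (suc Δ × 1ℚ) * 1/suc Δ                       ≡⟨ cong₂ _*_ (×1≡fromℤ (suc Δ)) (ℚₚ.normalize-coprime (1-coprimeTo (suc Δ))) ⟩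
    fromℤ (ℤ.+ suc Δ) * ℚ.1/ fromℤ (ℤ.+ suc Δ)   ≡⟨ ℚₚ.*-inverseʳ (fromℤ (ℤ.+ suc Δ)) ⟩
    1ℚ                                           ∎
    where open ≡-Reasoning

  suc×[1/suc*x]≡x : ∀ Δ x → suc Δ × (1/suc Δ * x) ≡ x
  suc×[1/suc*x]≡x Δ x = begin
    suc Δ × (1/suc Δ * x)   ≡⟨ sym (×-assoc-* (suc Δ) (1/suc Δ) x) ⟩
    (suc Δ × 1/suc Δ) * x   ≡⟨ cong (_* x) (suc×1/suc≡1 Δ) ⟩
    1ℚ * x                  ≡⟨ ℚₚ.*-identityˡ x ⟩
    x                       ∎
    where open ≡-Reasoning

  0≤1/suc : ∀ Δ → 0ℚ ≤ 1/suc Δ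
  0≤1/suc Δ = ℚₚ.nonNegative⁻¹ _ {{ℚₚ.normalize-nonNeg 1 (suc Δ)}}

  1/suc≤1 : ∀ Δ → 1/suc Δ ≤ 1ℚ
  1/suc≤1 Δ = subst (1/suc Δ ≤_) (suc×1/suc≡1 Δ) (x≤n×x {n = suc Δ} (0≤1/suc Δ) (s≤s z≤n))

  0≤½ : 0ℚ ≤ ½
  0≤½ = ℚₚ.nonNegative⁻¹ ½

  a+a≤1⇒a≤½ : a + a ≤ 1ℚ → a ≤ ½
  a+a≤1⇒a≤½ {a} a+a≤1 = begin
    a            ≡⟨ halve a ⟩
    ½ * (a + a)  ≤⟨ *-monoˡ-≤ 0≤½ a+a≤1 ⟩
    ½ * 1ℚ       ≡⟨ ℚₚ.*-identityʳ ½ ⟩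
    ½            ∎
    where
    open ℚₚ.≤-Reasoning
    halve : ∀ a → a ≡ ½ * (a + a)
    halve = solve-∀ ℚ-ring

  -- Bernoulli at h = ⌈Δ/2⌉ gives (1 - p)^h ≥ 1 - hp ≥ ½, and Δ ≤ 2h.
  ¼≤[1-1/suc]^Δ : ∀ Δ → ½ * ½ ≤ (1ℚ - 1/suc Δ) ^ Δ
  ¼≤[1-1/suc]^Δ Δ = begin
    ½ * ½           ≤⟨ *-mono-≤ 0≤½ 0≤½ ½≤q^h ½≤q^h ⟩
    q ^ h * q ^ h   ≡⟨ sym (^-homo-* q h h) ⟩
    q ^ (h ℕ.+ h)   ≤⟨ ^-antimonoʳ-≤ (a≤b⇒0≤b-a (1/suc≤1 Δ)) (a-b≤a (0≤1/suc Δ)) Δ≤h+h ⟩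
    q ^ Δ           ∎
    where
    open ℚₚ.≤-Reasoning
    p = 1/suc Δ
    q = 1ℚ - p
    h = ⌈ Δ /2⌉
    Δ≤h+h : Δ ℕ.≤ h ℕ.+ h
    Δ≤h+h = subst (ℕ._≤ h ℕ.+ h) (ℕₚ.⌊n/2⌋+⌈n/2⌉≡n Δ) (ℕₚ.+-monoˡ-≤ h (ℕₚ.⌊n/2⌋≤⌈n/2⌉ Δ))
    h+h≤1+Δ : h ℕ.+ h ℕ.≤ suc Δ
    h+h≤1+Δ = subst (h ℕ.+ h ℕ.≤_) (ℕₚ.⌊n/2⌋+⌈n/2⌉≡n (suc Δ))
                    (ℕₚ.+-monoʳ-≤ h (ℕₚ.⌈n/2⌉-mono (ℕₚ.n≤1+n Δ)))
    h×p≤½ : h × p ≤ ½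
    h×p≤½ = a+a≤1⇒a≤½ (begin
      h × p + h × p  ≡⟨ sym (×-homo-+ p h h) ⟩
      (h ℕ.+ h) × p  ≤⟨ ×-monoˡ-≤ (0≤1/suc Δ) h+h≤1+Δ ⟩
      suc Δ × p      ≡⟨ suc×1/suc≡1 Δ ⟩
      1ℚ             ∎)
    ½≤q^h : ½ ≤ q ^ h
    ½≤q^h = begin
      ½           ≡⟨⟩
      1ℚ - ½      ≤⟨ 1-x≤1-y h×p≤½ ⟩
      1ℚ - h × p  ≤⟨ bernoulli h (0≤1/suc Δ) (1/suc≤1 Δ) ⟩
      q ^ h       ∎

  isolationBound : ℕ → ℚ
  isolationBound Δ = 1/suc Δ * (1/suc Δ * (½ * ½))

  0≤isolationBound : ∀ Δ → 0ℚ ≤ isolationBound Δ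
  0≤isolationBound Δ = *-nonNeg (0≤1/suc Δ) (*-nonNeg (0≤1/suc Δ) (*-nonNeg 0≤½ 0≤½))

  [4[1+Δ]²]×isolationBound≡1 : ∀ Δ → (4 ℕ.* suc Δ ℕ.^ 2) × isolationBound Δ ≡ 1ℚ
  [4[1+Δ]²]×isolationBound≡1 Δ = begin
    (4 ℕ.* (suc Δ ℕ.* (suc Δ ℕ.* 1))) × σ   ≡⟨ sym (×-assocˡ σ 4 (suc Δ ℕ.* (suc Δ ℕ.* 1))) ⟩
    4 × ((suc Δ ℕ.* (suc Δ ℕ.* 1)) × σ)     ≡⟨ cong (4 ×_) (sym (×-assocˡ σ (suc Δ) (suc Δ ℕ.* 1))) ⟩
    4 × (suc Δ × ((suc Δ ℕ.* 1) × σ))       ≡⟨ cong (λ k → 4 × (suc Δ × (k × σ))) (ℕₚ.*-identityʳ (suc Δ)) ⟩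
    4 × (suc Δ × (suc Δ × σ))               ≡⟨ cong (λ z → 4 × (suc Δ × z)) (suc×[1/suc*x]≡x Δ _) ⟩
    4 × (suc Δ × (1/suc Δ * (½ * ½)))       ≡⟨ cong (4 ×_) (suc×[1/suc*x]≡x Δ _) ⟩
    4 × (½ * ½)                             ≡⟨⟩
    1ℚ                                      ∎
    where
    open ≡-Reasoning
    σ = isolationBound Δ

  isolationBound≤1 : ∀ Δ → isolationBound Δ ≤ 1ℚ
  isolationBound≤1 Δ = subst (isolationBound Δ ≤_) ([4[1+Δ]²]×isolationBound≡1 Δ)
                             (x≤n×x {n = 4 ℕ.* suc Δ ℕ.^ 2} (0≤isolationBound Δ) (s≤s z≤n))

  0≤[1-isolationBound]^ : ∀ Δ t → 0ℚ ≤ (1ℚ - isolationBound Δ) ^ t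
  0≤[1-isolationBound]^ Δ t = ^-nonNeg t (a≤b⇒0≤b-a (isolationBound≤1 Δ))

  2×[1-isolationBound]^[4[1+Δ]²]≤1 : ∀ Δ → 2 × (1ℚ - isolationBound Δ) ^ (4 ℕ.* suc Δ ℕ.^ 2) ≤ 1ℚ
  2×[1-isolationBound]^[4[1+Δ]²]≤1 Δ = begin
    2 × r                  ≡⟨ double r ⟩
    r * (1ℚ + 1ℚ)          ≡⟨ cong (λ z → r * (1ℚ + z)) (sym M×σ≡1) ⟩
    r * (1ℚ + M × σ)       ≤⟨ [1-x]^n*[1+n×x]≤1 M (0≤isolationBound Δ) (isolationBound≤1 Δ) ⟩
    1ℚ                     ∎
    where
    open ℚₚ.≤-Reasoning
    σ = isolationBound Δ
    M = 4 ℕ.* suc Δ ℕ.^ 2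
    r = (1ℚ - σ) ^ M
    M×σ≡1 : M × σ ≡ 1ℚ
    M×σ≡1 = [4[1+Δ]²]×isolationBound≡1 Δ
    double : ∀ r → r + (r + 0ℚ) ≡ r * (1ℚ + 1ℚ)
    double = solve-∀ ℚ-ring

  n≤⌈n/2⌉+⌈n/2⌉ : ∀ n → n ℕ.≤ ⌈ n /2⌉ ℕ.+ ⌈ n /2⌉
  n≤⌈n/2⌉+⌈n/2⌉ n = subst (ℕ._≤ ⌈ n /2⌉ ℕ.+ ⌈ n /2⌉) (ℕₚ.⌊n/2⌋+⌈n/2⌉≡n n)
                          (ℕₚ.+-monoˡ-≤ ⌈ n /2⌉ (ℕₚ.⌊n/2⌋≤⌈n/2⌉ n))

  n≤2^⌈log₂n⌉ : ∀ n → n ℕ.≤ 2 ℕ.^ ⌈log₂ n ⌉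
  n≤2^⌈log₂n⌉ n = go n (<-wellFounded n)
    where
    go : ∀ n (rec : Acc ℕ._<_ n) → n ℕ.≤ 2 ℕ.^ ⌈log2⌉ n rec
    go zero _ = z≤n
    go (suc zero) _ = s≤s z≤n
    go (suc (suc n)) (acc rec) = ℕₚ.≤-trans 2+n≤2[1+⌈n/2⌉] (ℕₚ.*-monoʳ-≤ 2 (go (suc ⌈ n /2⌉) _))
      where
      double : ∀ c → suc (suc (c ℕ.+ c)) ≡ 2 ℕ.* suc c
      double = ℕ-Solver.solve-∀
      2+n≤2[1+⌈n/2⌉] : suc (suc n) ℕ.≤ 2 ℕ.* suc ⌈ n /2⌉
      2+n≤2[1+⌈n/2⌉] = subst (suc (suc n) ℕ.≤_) (double ⌈ n /2⌉) (s≤s (s≤s (n≤⌈n/2⌉+⌈n/2⌉ n)))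

  queries : ℕ → ℕ → ℕ
  queries n Δ = 12 ℕ.* suc Δ ℕ.^ 2 ℕ.* ⌈log₂ n ⌉

  n³×[1-isolationBound]^t≤1 : ∀ n Δ → n × (n × (n × (1ℚ - isolationBound Δ) ^ queries n Δ)) ≤ 1ℚ
  n³×[1-isolationBound]^t≤1 n Δ = begin
    n × (n × (n × (1ℚ - σ) ^ (12 ℕ.* S ℕ.* L)))  ≡⟨ cong (λ z → n × (n × (n × z))) β≡r^k ⟩
    n × (n × (n × r ^ k))                       ≡⟨ cong (n ×_) (×-assocˡ (r ^ k) n n) ⟩
    n × ((n ℕ.* n) × r ^ k)                     ≡⟨ ×-assocˡ (r ^ k) n (n ℕ.* n) ⟩
    (n ℕ.* (n ℕ.* n)) × r ^ k                   ≤⟨ ×-monoˡ-≤ (^-nonNeg k 0≤r) n³≤2^k ⟩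
    (2 ℕ.^ k) × r ^ k                           ≡⟨ ×-distrib-^ 2 k ⟩
    (2 × r) ^ k                                 ≤⟨ x≤1⇒x^n≤1 k (×-nonNeg 2 0≤r) (2×[1-isolationBound]^[4[1+Δ]²]≤1 Δ) ⟩
    1ℚ                                          ∎
    where
    open ℚₚ.≤-Reasoning
    σ = isolationBound Δ
    S = suc Δ ℕ.^ 2
    L = ⌈log₂ n ⌉
    k = L ℕ.+ (L ℕ.+ L)
    r = (1ℚ - σ) ^ (4 ℕ.* S)
    0≤r : 0ℚ ≤ r
    0≤r = 0≤[1-isolationBound]^ Δ (4 ℕ.* S)
    regroup : ∀ S L → 12 ℕ.* S ℕ.* L ≡ 4 ℕ.* S ℕ.* (L ℕ.+ (L ℕ.+ L))
    regroup = ℕ-Solver.solve-∀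
    β≡r^k : (1ℚ - σ) ^ (12 ℕ.* S ℕ.* L) ≡ r ^ k
    β≡r^k = trans (cong ((1ℚ - σ) ^_) (regroup S L)) (sym (^-assocʳ (1ℚ - σ) (4 ℕ.* S) k))
    n³≤2^k : n ℕ.* (n ℕ.* n) ℕ.≤ 2 ℕ.^ k
    n³≤2^k = subst (n ℕ.* (n ℕ.* n) ℕ.≤_)
      (sym (trans (ℕₚ.^-distribˡ-+-* 2 L (L ℕ.+ L)) (cong (2 ℕ.^ L ℕ.*_) (ℕₚ.^-distribˡ-+-* 2 L L))))
      (ℕₚ.*-mono-≤ n≤2^L (ℕₚ.*-mono-≤ n≤2^L n≤2^L))
      where n≤2^L = n≤2^⌈log₂n⌉ n

  archimedean : 0ℚ < ε → ∃ λ N → 1ℚ ≤ suc N × ε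
  archimedean {mkℚ (ℤ.+ zero) _ _} (*<* (ℤ.+<+ ()))
  archimedean {mkℚ -[1+ _ ] _ _} (*<* ())
  -- ε = (k+1)/(N+1) ≥ 1/(N+1)
  archimedean {ε@(mkℚ +[1+ k ] N _)} _ = N , (begin
    1ℚ              ≡⟨ sym (suc×1/suc≡1 N) ⟩
    suc N × 1/suc N ≤⟨ ×-monoʳ-≤ (suc N) 1/suc≤ε ⟩
    suc N × ε       ∎)
    where
    open ℚₚ.≤-Reasoning
    1/suc≤ε : 1/suc N ≤ ε
    1/suc≤ε = subst (_≤ ε) (sym (ℚₚ.normalize-coprime (1-coprimeTo (suc N))))
                    (*≤* (ℤₚ.*-monoʳ-≤-nonNeg +[1+ N ] {ℤ.+ 1} {+[1+ k ]} (ℤ.+≤+ (s≤s z≤n))))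

  ×-cancelˡ-≤ : ∀ n → suc n × x ≤ suc n × y → x ≤ y
  ×-cancelˡ-≤ {x} {y} n n×x≤n×y =
    ℚₚ.*-cancelˡ-≤-pos (fromℤ (ℤ.+ suc n)) (subst₂ _≤_ (as-product x) (as-product y) n×x≤n×y)
    where
    as-product : ∀ z → suc n × z ≡ fromℤ (ℤ.+ suc n) * z
    as-product z = trans (n×x≡[n×1]*x (suc n) z) (cong (_* z) (×1≡fromℤ (suc n)))

  n²×[1-isolationBound]^t≤ε : 0ℚ < ε →
    ∃ λ N → ∀ {n} Δ → N ℕ.≤ n → n × (n × (1ℚ - isolationBound Δ) ^ queries n Δ) ≤ ε
  n²×[1-isolationBound]^t≤ε {ε} 0<ε with archimedean 0<ε
  ... | N , 1≤[1+N]ε = suc N , bound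
    where
    bound : ∀ {n} Δ → suc N ℕ.≤ n → n × (n × (1ℚ - isolationBound Δ) ^ queries n Δ) ≤ ε
    bound {suc n} Δ 1+N≤1+n = ×-cancelˡ-≤ n (begin
      suc n × (suc n × (suc n × β)) ≤⟨ n³×[1-isolationBound]^t≤1 (suc n) Δ ⟩
      1ℚ                            ≤⟨ 1≤[1+N]ε ⟩
      suc N × ε                     ≤⟨ ×-monoˡ-≤ (ℚₚ.<⇒≤ 0<ε) 1+N≤1+n ⟩
      suc n × ε                     ∎)
      where
      open ℚₚ.≤-Reasoning
      β = (1ℚ - isolationBound Δ) ^ queries (suc n) Δ

  -- Finite sums and weighted events

  ∑ : List A → (A → ℚ) → ℚ
  ∑ xs f = sumℚ (map f xs)

  syntax ∑ xs (λ x → e) = ∑[ x ∈ xs ] e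

  ∑-++ : ∀ (xs ys : List A) (f : A → ℚ) → ∑ (xs ++ ys) f ≡ ∑ xs f + ∑ ys f
  ∑-++ [] ys f = sym (ℚₚ.+-identityˡ (∑ ys f))
  ∑-++ (x ∷ xs) ys f = trans (cong (f x +_) (∑-++ xs ys f)) (sym (ℚₚ.+-assoc (f x) (∑ xs f) (∑ ys f)))

  ∑-concatMap : ∀ (g : A → List B) xs (f : B → ℚ) → ∑ (concatMap g xs) f ≡ ∑[ x ∈ xs ] ∑ (g x) f
  ∑-concatMap g [] f = refl
  ∑-concatMap g (x ∷ xs) f = trans (∑-++ (g x) (concatMap g xs) f) (cong (∑ (g x) f +_) (∑-concatMap g xs f))

  ∑-map : ∀ (g : A → B) xs (f : B → ℚ) → ∑ (map g xs) f ≡ ∑[ x ∈ xs ] f (g x)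
  ∑-map g [] f = refl
  ∑-map g (x ∷ xs) f = cong (f (g x) +_) (∑-map g xs f)

  ∑-cong : ∀ (xs : List A) {f g : A → ℚ} → (∀ x → f x ≡ g x) → ∑ xs f ≡ ∑ xs g
  ∑-cong [] _ = refl
  ∑-cong (x ∷ xs) f≗g = cong₂ _+_ (f≗g x) (∑-cong xs f≗g)

  ∑-zero : ∀ (xs : List A) → ∑[ x ∈ xs ] 0ℚ ≡ 0ℚ
  ∑-zero [] = refl
  ∑-zero (x ∷ xs) = trans (ℚₚ.+-identityˡ _) (∑-zero xs)

  ∑-distrib-+ : ∀ (xs : List A) (f g : A → ℚ) → ∑[ x ∈ xs ] (f x + g x) ≡ ∑ xs f + ∑ xs g
  ∑-distrib-+ [] f g = refl
  ∑-distrib-+ (x ∷ xs) f g = trans (cong (f x + g x +_) (∑-distrib-+ xs f g)) (interchange (f x) (g x) (∑ xs f) (∑ xs g))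
    where
    interchange : ∀ a b c d → (a + b) + (c + d) ≡ (a + c) + (b + d)
    interchange = solve-∀ ℚ-ring

  *-distribˡ-∑ : ∀ c (xs : List A) (f : A → ℚ) → ∑[ x ∈ xs ] (c * f x) ≡ c * ∑ xs f
  *-distribˡ-∑ c [] f = sym (ℚₚ.*-zeroʳ c)
  *-distribˡ-∑ c (x ∷ xs) f = trans (cong (c * f x +_) (*-distribˡ-∑ c xs f)) (sym (ℚₚ.*-distribˡ-+ c (f x) (∑ xs f)))

  *-distribʳ-∑ : ∀ c (xs : List A) (f : A → ℚ) → ∑[ x ∈ xs ] (f x * c) ≡ ∑ xs f * c
  *-distribʳ-∑ c xs f = begin
    ∑[ x ∈ xs ] (f x * c)  ≡⟨ ∑-cong xs (λ x → ℚₚ.*-comm (f x) c) ⟩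
    ∑[ x ∈ xs ] (c * f x)  ≡⟨ *-distribˡ-∑ c xs f ⟩
    c * ∑ xs f             ≡⟨ ℚₚ.*-comm c (∑ xs f) ⟩
    ∑ xs f * c             ∎
    where open ≡-Reasoning

  ∑-comm : ∀ (xs : List A) (ys : List B) (f : A → B → ℚ) →
    ∑[ x ∈ xs ] ∑[ y ∈ ys ] f x y ≡ ∑[ y ∈ ys ] ∑[ x ∈ xs ] f x y
  ∑-comm [] ys f = sym (∑-zero ys)
  ∑-comm (x ∷ xs) ys f = trans (cong (∑ ys (f x) +_) (∑-comm xs ys f)) (sym (∑-distrib-+ ys (f x) _))

  ∑-const : ∀ (xs : List A) c → ∑[ x ∈ xs ] c ≡ length xs × c
  ∑-const [] c = refl
  ∑-const (x ∷ xs) c = cong (c +_) (∑-const xs c)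

  ∑-allFin-const : ∀ n c → ∑[ i ∈ allFin n ] c ≡ n × c
  ∑-allFin-const n c = trans (∑-const (allFin n) c) (cong (_× c) (Listₚ.length-tabulate {n = n} (λ i → i)))

  ∑-mono-≤ : ∀ (xs : List A) {f g : A → ℚ} → (∀ x → f x ≤ g x) → ∑ xs f ≤ ∑ xs g
  ∑-mono-≤ [] _ = ℚₚ.≤-refl
  ∑-mono-≤ (x ∷ xs) f≤g = ℚₚ.+-mono-≤ (f≤g x) (∑-mono-≤ xs f≤g)

  ∑-nonNeg : ∀ (xs : List A) {f : A → ℚ} → (∀ x → 0ℚ ≤ f x) → 0ℚ ≤ ∑ xs f
  ∑-nonNeg [] _ = ℚₚ.≤-refl
  ∑-nonNeg (x ∷ xs) 0≤f = ℚₚ.+-mono-≤ (0≤f x) (∑-nonNeg xs 0≤f)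

  term≤∑ : ∀ {xs : List A} {x} (f : A → ℚ) → (∀ x → 0ℚ ≤ f x) → x ∈ xs → f x ≤ ∑ xs f
  term≤∑ {xs = y ∷ xs} f 0≤f (here refl) = a≤a+b (∑-nonNeg xs 0≤f)
  term≤∑ {xs = y ∷ xs} {x} f 0≤f (there x∈xs) = begin
    f x             ≤⟨ term≤∑ f 0≤f x∈xs ⟩
    ∑ xs f          ≡⟨ sym (ℚₚ.+-identityˡ (∑ xs f)) ⟩
    0ℚ + ∑ xs f     ≤⟨ ℚₚ.+-monoˡ-≤ (∑ xs f) (0≤f y) ⟩
    f y + ∑ xs f    ∎
    where open ℚₚ.≤-Reasoning

  indicator : Bool → ℚ → ℚ
  indicator b x = if b then x else 0ℚ

  indicator-nonNeg : ∀ b → 0ℚ ≤ x → 0ℚ ≤ indicator b x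
  indicator-nonNeg true 0≤x = 0≤x
  indicator-nonNeg false _ = ℚₚ.≤-refl

  indicator-true : ∀ {b} → T b → indicator b x ≡ x
  indicator-true {b = true} _ = refl

  indicator-false : ∀ {b} → ¬ T b → indicator b x ≡ 0ℚ
  indicator-false {b = false} _ = refl
  indicator-false {b = true} ¬b = ⊥-elim (¬b tt)

  indicator-∧ : ∀ b c x y → indicator (b ∧ c) (x * y) ≡ indicator b x * indicator c y
  indicator-∧ true true x y = refl
  indicator-∧ true false x y = sym (ℚₚ.*-zeroʳ x)
  indicator-∧ false c x y = sym (ℚₚ.*-zeroˡ (indicator c y))

  mass : List A → (A → ℚ) → (A → Bool) → ℚ
  mass xs w E = ∑[ x ∈ xs ] indicator (E x) (w x)

  mass-certain : ∀ (xs : List A) (w : A → ℚ) {E : A → Bool} → (∀ x → T (E x)) → mass xs w E ≡ ∑ xs w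
  mass-certain xs w certain = ∑-cong xs (indicator-true ∘ certain)

  mass-impossible : ∀ (xs : List A) (w : A → ℚ) {E : A → Bool} → (∀ x → ¬ T (E x)) → mass xs w E ≡ 0ℚ
  mass-impossible xs w impossible = trans (∑-cong xs (indicator-false ∘ impossible)) (∑-zero xs)

  mass-complement : ∀ (xs : List A) (w : A → ℚ) (E : A → Bool) → mass xs w E + mass xs w (not ∘ E) ≡ ∑ xs w
  mass-complement xs w E = trans (sym (∑-distrib-+ xs _ _)) (∑-cong xs split)
    where
    split : ∀ x → indicator (E x) (w x) + indicator (not (E x)) (w x) ≡ w x
    split x with E x
    ... | true = ℚₚ.+-identityʳ (w x)
    ... | false = ℚₚ.+-identityˡ (w x)

  mass-not : ∀ (xs : List A) {w : A → ℚ} E → ∑ xs w ≡ 1ℚ → mass xs w (not ∘ E) ≡ 1ℚ - mass xs w E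
  mass-not xs {w} E total = begin
    mass xs w (not ∘ E)                                ≡⟨ cancel (mass xs w E) (mass xs w (not ∘ E)) ⟩
    (mass xs w E + mass xs w (not ∘ E)) - mass xs w E  ≡⟨ cong (_- mass xs w E) (trans (mass-complement xs w E) total) ⟩
    1ℚ - mass xs w E                                   ∎
    where
    open ≡-Reasoning
    cancel : ∀ a b → b ≡ (a + b) - a
    cancel = solve-∀ ℚ-ring

  mass-nonNeg : ∀ (xs : List A) {w : A → ℚ} E → (∀ x → 0ℚ ≤ w x) → 0ℚ ≤ mass xs w E
  mass-nonNeg xs E 0≤w = ∑-nonNeg xs (λ x → indicator-nonNeg (E x) (0≤w x))

  mass-mono : ∀ (xs : List A) {w : A → ℚ} {E F : A → Bool} → (∀ x → 0ℚ ≤ w x) →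
    (∀ x → T (E x) → T (F x)) → mass xs w E ≤ mass xs w F
  mass-mono xs {w} {E} {F} 0≤w E⇒F = ∑-mono-≤ xs pointwise
    where
    pointwise : ∀ x → indicator (E x) (w x) ≤ indicator (F x) (w x)
    pointwise x with E x | F x | E⇒F x
    ... | false | b | _ = indicator-nonNeg b (0≤w x)
    ... | true | true | _ = ℚₚ.≤-refl
    ... | true | false | Ex⇒Fx = ⊥-elim (Ex⇒Fx tt)

  union-bound : ∀ (xs : List A) {w : A → ℚ} {E : A → Bool} (is : List I) (B : I → A → Bool) → (∀ x → 0ℚ ≤ w x) →
    (∀ x → T (E x) → Any (λ i → T (B i x)) is) → mass xs w E ≤ ∑[ i ∈ is ] mass xs w (B i)
  union-bound xs {w} {E} is B 0≤w cover = begin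
    mass xs w E                                      ≤⟨ ∑-mono-≤ xs pointwise ⟩
    ∑[ x ∈ xs ] ∑[ i ∈ is ] indicator (B i x) (w x)  ≡⟨ ∑-comm xs is (λ x i → indicator (B i x) (w x)) ⟩
    ∑[ i ∈ is ] mass xs w (B i)                      ∎
    where
    open ℚₚ.≤-Reasoning
    pointwise : ∀ x → indicator (E x) (w x) ≤ ∑[ i ∈ is ] indicator (B i x) (w x)
    pointwise x with E x | cover x
    ... | false | _ = ∑-nonNeg is (λ i → indicator-nonNeg (B i x) (0≤w x))
    ... | true | covered with find (covered tt)
    ...   | i , i∈is , Bix = begin
      w x                                  ≡⟨ indicator-true Bix ⟨
      indicator (B i x) (w x)              ≤⟨ term≤∑ (λ j → indicator (B j x) (w x))
                                                     (λ j → indicator-nonNeg (B j x) (0≤w x)) i∈is ⟩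
      ∑[ j ∈ is ] indicator (B j x) (w x)  ∎

  -- Separating non-edges

  T-not⇒¬T : ∀ {b} → T (not b) → ¬ T b
  T-not⇒¬T {false} _ ()

  ¬T⇒T-not : ∀ {b} → ¬ T b → T (not b)
  ¬T⇒T-not {false} _ = tt
  ¬T⇒T-not {true} ¬b = ¬b tt

  walkWithin-refl : ∀ (G : Graph n) {Q u} k → T (u ∈ᵇ Q) → T (walkWithin G Q k u u)
  walkWithin-refl G {Q} {u} zero u∈Q = T-∧ {u ∈ᵇ Q} .from (u∈Q , fromWitness refl)
  walkWithin-refl G {Q} {u} (suc k) u∈Q = T-∨ {walkWithin G Q k u u} .from (inj₁ (walkWithin-refl G k u∈Q))

  edge⇒sameComponent : ∀ (G : Graph n) {Q u v} → T (u ∈ᵇ Q) → T (v ∈ᵇ Q) → T (G u v) → T (sameComponent G Q u v)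
  edge⇒sameComponent {suc m} G {Q} {u} {v} u∈Q v∈Q uv = T-∨ {walkWithin G Q m u v} .from (inj₂ (any⁺ _ (lose (∈-allFin u)
    (T-∧ {walkWithin G Q m u u} .from (walkWithin-refl G m u∈Q , T-∧ {G u v} .from (uv , v∈Q))))))

  edge⇒¬separates : ∀ (G : Graph n) Q {u v} → T (G u v) → ¬ T (separates G Q u v)
  edge⇒¬separates G Q {u} {v} uv separated =
    let u∈Q , v∈Q∧apart = T-∧ {u ∈ᵇ Q} .to separated
        v∈Q , apart = T-∧ {v ∈ᵇ Q} .to v∈Q∧apart
    in T-not⇒¬T apart (edge⇒sameComponent G u∈Q v∈Q uv)

  walkWithin-isolated : ∀ (G : Graph n) {Q u} → (∀ w → T (G u w) → ¬ T (w ∈ᵇ Q)) →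
    ∀ k {w} → T (walkWithin G Q k u w) → u ≡ w
  walkWithin-isolated G {Q} {u} isolated zero walk = toWitness (proj₂ (T-∧ {u ∈ᵇ Q} .to walk))
  walkWithin-isolated {n} G {Q} {u} isolated (suc k) {w} walk with T-∨ {walkWithin G Q k u w} .to walk
  ... | inj₁ shorter = walkWithin-isolated G isolated k shorter
  ... | inj₂ extended with satisfied (any⁻ _ (allFin n) extended)
  ...   | w′ , walk∧step with T-∧ {walkWithin G Q k u w′} .to walk∧step
  ...     | shorter , step with T-∧ {G w′ w} .to step | walkWithin-isolated G isolated k shorter
  ...       | w′w , w∈Q | refl = ⊥-elim (isolated _ w′w w∈Q)

  -- A pattern prescribes the membership (just b) of some vertices and leaves the others (nothing) free.
  allows : Maybe Bool → Bool → Bool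
  allows nothing _ = true
  allows (just true) b = b
  allows (just false) b = not b

  matches : (Fin n → Maybe Bool) → Subset n → Bool
  matches c [] = true
  matches c (b ∷ Q) = allows (c zero) b ∧ matches (c ∘ suc) Q

  matches-unconstrained : ∀ (Q : Subset n) → T (matches (λ _ → nothing) Q)
  matches-unconstrained [] = tt
  matches-unconstrained (b ∷ Q) = matches-unconstrained Q

  matches⇒allows : ∀ (c : Fin n → Maybe Bool) {Q} → T (matches c Q) → ∀ i → T (allows (c i) (i ∈ᵇ Q))
  matches⇒allows c {b ∷ Q} m zero = proj₁ (T-∧ {allows (c zero) b} .to m)
  matches⇒allows c {b ∷ Q} m (suc i) = matches⇒allows (c ∘ suc) {Q} (proj₂ (T-∧ {allows (c zero) b} .to m)) i

  isolationConstraint : (adjacent endpoint : Bool) → Maybe Bool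
  isolationConstraint true _ = just false
  isolationConstraint false true = just true
  isolationConstraint false false = nothing

  isolating : Graph n → Fin n → Fin n → Fin n → Maybe Bool
  isolating G u v i = isolationConstraint (G u i) (⌊ i ≟ u ⌋ ∨ ⌊ i ≟ v ⌋)

  isolating⇒separates : ∀ (G : Graph n) {Q u v} → u ≢ v → ¬ T (G u u) → ¬ T (G u v) →
    T (matches (isolating G u v) Q) → T (separates G Q u v)
  isolating⇒separates {n} G {Q} {u} {v} u≢v ¬uu ¬uv m =
    T-∧ {u ∈ᵇ Q} .from (u∈Q , T-∧ {v ∈ᵇ Q} .from (v∈Q , apart))
    where
    allowed : ∀ i → T (allows (isolating G u v i) (i ∈ᵇ Q))
    allowed = matches⇒allows (isolating G u v) {Q} m
    endpoint-in : ∀ a e {b} → ¬ T a → T e → T (allows (isolationConstraint a e) b) → T b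
    endpoint-in true _ ¬a = ⊥-elim (¬a tt)
    endpoint-in false true _ _ b = b
    neighbour-out : ∀ e {b} → T (allows (isolationConstraint true e) b) → ¬ T b
    neighbour-out e {false} _ ()
    u∈Q : T (u ∈ᵇ Q)
    u∈Q = endpoint-in (G u u) (⌊ u ≟ u ⌋ ∨ ⌊ u ≟ v ⌋) ¬uu
            (T-∨ {⌊ u ≟ u ⌋} .from (inj₁ (fromWitness refl))) (allowed u)
    v∈Q : T (v ∈ᵇ Q)
    v∈Q = endpoint-in (G u v) (⌊ v ≟ u ⌋ ∨ ⌊ v ≟ v ⌋) ¬uv
            (T-∨ {⌊ v ≟ u ⌋} .from (inj₂ (fromWitness refl))) (allowed v)
    isolated : ∀ w → T (G u w) → ¬ T (w ∈ᵇ Q)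
    isolated w uw with G u w | allowed w
    ... | true | a = neighbour-out (⌊ w ≟ u ⌋ ∨ ⌊ w ≟ v ⌋) a
    apart : T (not (sameComponent G Q u v))
    apart with sameComponent G Q u v in same
    ... | false = tt
    ... | true = u≢v (walkWithin-isolated G isolated n (subst T (sym same) tt))

  every : (A → Bool) → Vec A t → Bool
  every f = all f ∘ V.toList

  every-true : ∀ (xs : Vec A t) → T (every (λ _ → true) xs)
  every-true [] = tt
  every-true (x ∷ xs) = every-true xs

  separatedBySome : Graph n → Vec (Subset n) t → Fin n → Fin n → Bool
  separatedBySome G Qs u v = V.foldr _ (λ Q b → separates G Q u v ∨ b) false Qs

  spurious : Graph n → Vec (Subset n) t → Fin n → Fin n → Bool
  spurious G Qs u v = output G Qs u v ∧ not (G u v)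

  edge⇒¬separatedBySome : ∀ (G : Graph n) {u v} → T (G u v) → ∀ (Qs : Vec (Subset n) t) → ¬ T (separatedBySome G Qs u v)
  edge⇒¬separatedBySome G uv [] ()
  edge⇒¬separatedBySome G {u} {v} uv (Q ∷ Qs) =
    [ edge⇒¬separates G Q uv , edge⇒¬separatedBySome G uv Qs ] ∘ T-∨ {separates G Q u v} .to

  unseparated⇒unisolated : ∀ (G : Graph n) {u v} → u ≢ v → ¬ T (G u u) → ¬ T (G u v) →
    ∀ (Qs : Vec (Subset n) t) → ¬ T (separatedBySome G Qs u v) → T (every (not ∘ matches (isolating G u v)) Qs)
  unseparated⇒unisolated G u≢v ¬uu ¬uv [] _ = tt
  unseparated⇒unisolated G {u} {v} u≢v ¬uu ¬uv (Q ∷ Qs) unseparated = T-∧ {not (matches (isolating G u v) Q)} .from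
    ( ¬T⇒T-not (unseparated ∘ T-∨ {separates G Q u v} .from ∘ inj₁ ∘ isolating⇒separates G {Q} u≢v ¬uu ¬uv)
    , unseparated⇒unisolated G u≢v ¬uu ¬uv Qs (unseparated ∘ T-∨ {separates G Q u v} .from ∘ inj₂))

  spurious⇒≢ : ∀ (G : Graph n) {Qs : Vec (Subset n) t} {u v} → T (spurious G Qs u v) → u ≢ v
  spurious⇒≢ G {Qs} {u} {v} s =
    toWitnessFalse (proj₁ (T-∧ {not ⌊ u ≟ v ⌋} .to (proj₁ (T-∧ {output G Qs u v} .to s))))

  spurious⇒unseparated : ∀ (G : Graph n) {Qs : Vec (Subset n) t} {u v} → T (spurious G Qs u v) → ¬ T (separatedBySome G Qs u v)
  spurious⇒unseparated G {Qs} {u} {v} s =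
    T-not⇒¬T (proj₂ (T-∧ {not ⌊ u ≟ v ⌋} .to (proj₁ (T-∧ {output G Qs u v} .to s))))

  spurious⇒nonEdge : ∀ (G : Graph n) {Qs : Vec (Subset n) t} {u v} → T (spurious G Qs u v) → ¬ T (G u v)
  spurious⇒nonEdge G {Qs} {u} {v} s = T-not⇒¬T (proj₂ (T-∧ {output G Qs u v} .to s))

  edge⇒output : ∀ (G : Graph n) → IsSimple G → ∀ (Qs : Vec (Subset n) t) {u v} → T (G u v) → T (output G Qs u v)
  edge⇒output G (_ , loopless) Qs {u} {v} uv = T-∧ {not ⌊ u ≟ v ⌋} .from
    (fromWitnessFalse u≢v , ¬T⇒T-not (edge⇒¬separatedBySome G uv Qs))
    where
    u≢v : u ≢ v
    u≢v refl = subst T (loopless u) uv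

  ¬all⇒∃¬ : ∀ (f : A → Bool) xs → ¬ T (all f xs) → ∃ λ x → ¬ T (f x)
  ¬all⇒∃¬ f xs ¬all = satisfied (¬All⇒Any¬ (T? ∘ f) xs (¬all ∘ all⁻ f))

  ¬graphEq⇒extraEdge : ∀ (H G : Graph n) → (∀ u v → T (G u v) → T (H u v)) → ¬ T (graphEq H G) →
    ∃ λ u → ∃ λ v → T (H u v ∧ not (G u v))
  ¬graphEq⇒extraEdge {n} H G G⊆H ¬H≡G with ¬all⇒∃¬ _ (allFin n) ¬H≡G
  ... | u , ¬H≡Gᵤ with ¬all⇒∃¬ _ (allFin n) ¬H≡Gᵤ
  ... | v , ¬H≡Gᵤᵥ with H u v in eqH | G u v in eqG | G⊆H u v
  ... | true | false | _ = u , v , subst₂ (λ h g → T (h ∧ not g)) (sym eqH) (sym eqG) tt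
  ... | true | true | _ = ⊥-elim (¬H≡Gᵤᵥ tt)
  ... | false | false | _ = ⊥-elim (¬H≡Gᵤᵥ tt)
  ... | false | true | G⇒H = ⊥-elim (G⇒H tt)

  ≤-foldr-⊔ : ∀ {xs : List ℕ} {x} → x ∈ xs → x ℕ.≤ foldr ℕ._⊔_ 0 xs
  ≤-foldr-⊔ {y ∷ _} (here refl) = ℕₚ.m≤m⊔n y _
  ≤-foldr-⊔ {y ∷ _} (there x∈xs) = ℕₚ.≤-trans (≤-foldr-⊔ x∈xs) (ℕₚ.m≤n⊔m y _)

  degree≤maxDegree : ∀ (G : Graph n) u → degree G u ℕ.≤ maxDegree G
  degree≤maxDegree G u = ≤-foldr-⊔ (∈-map⁺ (degree G) (∈-allFin u))

  -- The sampling distribution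

  -- Needed because ⌊_⌋ does not compute through the map′ in the definition of suc i ≟ suc j.
  ⌊suc≟suc⌋ : ∀ (i j : Fin n) → ⌊ suc i ≟ suc j ⌋ ≡ ⌊ i ≟ j ⌋
  ⌊suc≟suc⌋ i j with i ≟ j
  ... | yes _ = refl
  ... | no _ = refl

  ∏-if-≟ : ∀ (u : Fin n) x → ∏ (λ i → if ⌊ i ≟ u ⌋ then x else 1ℚ) ≡ x
  ∏-if-≟ {suc n} zero x = trans (cong (x *_) (∏-replicate-1 n)) (ℚₚ.*-identityʳ x)
  ∏-if-≟ {suc n} (suc u) x = begin
    1ℚ * ∏ (λ i → if ⌊ suc i ≟ suc u ⌋ then x else 1ℚ)  ≡⟨ ℚₚ.*-identityˡ _ ⟩
    ∏ (λ i → if ⌊ suc i ≟ suc u ⌋ then x else 1ℚ)       ≡⟨ ∏-cong (λ i → cong (if_then x else 1ℚ) (⌊suc≟suc⌋ i u)) ⟩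
    ∏ (λ i → if ⌊ i ≟ u ⌋ then x else 1ℚ)               ≡⟨ ∏-if-≟ u x ⟩
    x                                                   ∎
    where open ≡-Reasoning

  ∏-if≡^count : ∀ (f : Fin n → A) (h : A → Bool) x →
    ∏ (λ i → if h (f i) then x else 1ℚ) ≡ x ^ length (filterᵇ h (tabulate f))
  ∏-if≡^count {zero} f h x = refl
  ∏-if≡^count {suc n} f h x with h (f zero)
  ... | true = cong (x *_) (∏-if≡^count (f ∘ suc) h x)
  ... | false = trans (ℚₚ.*-identityˡ (∏ (λ i → if h (f (suc i)) then x else 1ℚ))) (∏-if≡^count (f ∘ suc) h x)


  module Sampling (p : ℚ) (0≤p : 0ℚ ≤ p) (p≤1 : p ≤ 1ℚ) where

    Pr : (Subset n → Bool) → ℚ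
    Pr {n} = mass (allSubsets n) (subsetWeight p)

    Prˢ : (Vec (Subset n) t → Bool) → ℚ
    Prˢ {n} {t} = mass (allSeqs n t) (seqWeight p)

    subsetWeight-nonNeg : ∀ (Q : Subset n) → 0ℚ ≤ subsetWeight p Q
    subsetWeight-nonNeg [] = 0≤1
    subsetWeight-nonNeg (true ∷ Q) = *-nonNeg 0≤p (subsetWeight-nonNeg Q)
    subsetWeight-nonNeg (false ∷ Q) = *-nonNeg (a≤b⇒0≤b-a p≤1) (subsetWeight-nonNeg Q)

    seqWeight-nonNeg : ∀ (Qs : Vec (Subset n) t) → 0ℚ ≤ seqWeight p Qs
    seqWeight-nonNeg [] = 0≤1
    seqWeight-nonNeg (Q ∷ Qs) = *-nonNeg (subsetWeight-nonNeg Q) (seqWeight-nonNeg Qs)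

    weight : Maybe Bool → ℚ
    weight nothing = 1ℚ
    weight (just true) = p
    weight (just false) = 1ℚ - p

    weight-split : ∀ m → indicator (allows m true) p + indicator (allows m false) (1ℚ - p) ≡ weight m
    weight-split nothing = p+[1-p]≡1 p
      where
      p+[1-p]≡1 : ∀ p → p + (1ℚ - p) ≡ 1ℚ
      p+[1-p]≡1 = solve-∀ ℚ-ring
    weight-split (just true) = ℚₚ.+-identityʳ p
    weight-split (just false) = ℚₚ.+-identityˡ (1ℚ - p)

    Pr-matches : ∀ (c : Fin n → Maybe Bool) → Pr (matches c) ≡ ∏ (weight ∘ c)
    Pr-matches {zero} c = refl
    Pr-matches {suc n} c = begin
      Pr (matches c)                                         ≡⟨ ∑-concatMap (λ Q → (true ∷ Q) ∷ (false ∷ Q) ∷ []) (allSubsets n) F ⟩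
      ∑[ Q ∈ allSubsets n ] (F (true ∷ Q) + (F (false ∷ Q) + 0ℚ))  ≡⟨ ∑-cong (allSubsets n) split ⟩
      ∑[ Q ∈ allSubsets n ] (weight (c zero) * F′ Q)          ≡⟨ *-distribˡ-∑ (weight (c zero)) (allSubsets n) F′ ⟩
      weight (c zero) * Pr (matches (c ∘ suc))               ≡⟨ cong (weight (c zero) *_) (Pr-matches (c ∘ suc)) ⟩
      ∏ (weight ∘ c)                                         ∎
      where
      open ≡-Reasoning
      F : Subset (suc n) → ℚ
      F Q = indicator (matches c Q) (subsetWeight p Q)
      F′ : Subset n → ℚ
      F′ Q = indicator (matches (c ∘ suc) Q) (subsetWeight p Q)
      factor : ∀ a b z → a * z + (b * z + 0ℚ) ≡ (a + b) * z
      factor = solve-∀ ℚ-ring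
      split : ∀ Q → F (true ∷ Q) + (F (false ∷ Q) + 0ℚ) ≡ weight (c zero) * F′ Q
      split Q = begin
        F (true ∷ Q) + (F (false ∷ Q) + 0ℚ)
          ≡⟨ cong₂ (λ u v → u + (v + 0ℚ)) (indicator-∧ (allows (c zero) true) (matches (c ∘ suc) Q) p (subsetWeight p Q))
                                           (indicator-∧ (allows (c zero) false) (matches (c ∘ suc) Q) (1ℚ - p) (subsetWeight p Q)) ⟩
        u * F′ Q + (v * F′ Q + 0ℚ)  ≡⟨ factor u v (F′ Q) ⟩
        (u + v) * F′ Q              ≡⟨ cong (_* F′ Q) (weight-split (c zero)) ⟩
        weight (c zero) * F′ Q      ∎
        where
        u = indicator (allows (c zero) true) p
        v = indicator (allows (c zero) false) (1ℚ - p)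

    Pr-total : ∀ n → ∑ (allSubsets n) (subsetWeight p) ≡ 1ℚ
    Pr-total n = begin
      ∑ (allSubsets n) (subsetWeight p)  ≡⟨ mass-certain (allSubsets n) (subsetWeight p) matches-unconstrained ⟨
      Pr {n} (matches (λ _ → nothing))   ≡⟨ Pr-matches {n} (λ _ → nothing) ⟩
      ∏ (λ (_ : Fin n) → 1ℚ)             ≡⟨ ∏-replicate-1 n ⟩
      1ℚ                                 ∎
      where open ≡-Reasoning

    Prˢ-every : ∀ t (f : Subset n → Bool) → Prˢ (every {t = t} f) ≡ Pr f ^ t
    Prˢ-every zero f = refl
    Prˢ-every {n} (suc t) f = begin
      Prˢ {n} {suc t} (every f)
        ≡⟨ ∑-concatMap (λ Q → map (Q ∷_) (allSeqs n t)) (allSubsets n) F ⟩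
      ∑[ Q ∈ allSubsets n ] ∑ (map (Q ∷_) (allSeqs n t)) F
        ≡⟨ ∑-cong (allSubsets n) (λ Q → ∑-map (Q ∷_) (allSeqs n t) F) ⟩
      ∑[ Q ∈ allSubsets n ] ∑[ Qs ∈ allSeqs n t ] indicator (f Q ∧ every f Qs) (subsetWeight p Q * seqWeight p Qs)
        ≡⟨ ∑-cong (allSubsets n) (λ Q → ∑-cong (allSeqs n t) (λ Qs →
             indicator-∧ (f Q) (every f Qs) (subsetWeight p Q) (seqWeight p Qs))) ⟩
      ∑[ Q ∈ allSubsets n ] ∑[ Qs ∈ allSeqs n t ] (f′ Q * indicator (every f Qs) (seqWeight p Qs))
        ≡⟨ ∑-cong (allSubsets n) (λ Q → *-distribˡ-∑ (f′ Q) (allSeqs n t) _) ⟩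
      ∑[ Q ∈ allSubsets n ] (f′ Q * Prˢ (every {t = t} f))
        ≡⟨ *-distribʳ-∑ (Prˢ (every {t = t} f)) (allSubsets n) f′ ⟩
      Pr f * Prˢ (every {t = t} f)
        ≡⟨ cong (Pr f *_) (Prˢ-every t f) ⟩
      Pr f * Pr f ^ t
        ∎
      where
      open ≡-Reasoning
      F : Vec (Subset n) (suc t) → ℚ
      F Qs = indicator (every f Qs) (seqWeight p Qs)
      f′ : Subset n → ℚ
      f′ Q = indicator (f Q) (subsetWeight p Q)

    Prˢ-total : ∀ n t → ∑ (allSeqs n t) (seqWeight p) ≡ 1ℚ
    Prˢ-total n t = begin
      ∑ (allSeqs n t) (seqWeight p)  ≡⟨ mass-certain (allSeqs n t) (seqWeight p) every-true ⟨
      Prˢ {n} {t} (every (λ _ → true)) ≡⟨ Prˢ-every t (λ _ → true) ⟩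
      Pr {n} (λ _ → true) ^ t          ≡⟨ cong (_^ t) (trans (mass-certain (allSubsets n) (subsetWeight p) (λ _ → tt))
                                                             (Pr-total n)) ⟩
      1ℚ ^ t                         ≡⟨ 1^n≡1 t ⟩
      1ℚ                             ∎
      where open ≡-Reasoning

    weight-isolationConstraint : ∀ a e₁ e₂ → (T a → ¬ T e₁) → (T a → ¬ T e₂) → (T e₁ → ¬ T e₂) →
      weight (isolationConstraint a (e₁ ∨ e₂)) ≡
      (if e₁ then p else 1ℚ) * ((if e₂ then p else 1ℚ) * (if a then 1ℚ - p else 1ℚ))
    weight-isolationConstraint true true _ a⇒¬e₁ _ _ = ⊥-elim (a⇒¬e₁ tt tt)
    weight-isolationConstraint true false true _ a⇒¬e₂ _ = ⊥-elim (a⇒¬e₂ tt tt)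
    weight-isolationConstraint true false false _ _ _ = sym (trans (ℚₚ.*-identityˡ _) (ℚₚ.*-identityˡ (1ℚ - p)))
    weight-isolationConstraint false true true _ _ e₁⇒¬e₂ = ⊥-elim (e₁⇒¬e₂ tt tt)
    weight-isolationConstraint false true false _ _ _ = sym (ℚₚ.*-identityʳ p)
    weight-isolationConstraint false false true _ _ _ = sym (trans (ℚₚ.*-identityˡ _) (ℚₚ.*-identityʳ p))
    weight-isolationConstraint false false false _ _ _ = refl

    Pr-isolating : ∀ (G : Graph n) {u v} → u ≢ v → ¬ T (G u u) → ¬ T (G u v) →
      Pr (matches (isolating G u v)) ≡ p * (p * (1ℚ - p) ^ degree G u)
    Pr-isolating {n} G {u} {v} u≢v ¬uu ¬uv = begin
      Pr (matches (isolating G u v))      ≡⟨ Pr-matches (isolating G u v) ⟩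
      ∏ (weight ∘ isolating G u v)        ≡⟨ ∏-cong factorise ⟩
      ∏ (λ i → atU i * (atV i * adjU i))  ≡⟨ ∏-distrib-* atU (λ i → atV i * adjU i) ⟩
      ∏ atU * ∏ (λ i → atV i * adjU i)    ≡⟨ cong₂ _*_ (∏-if-≟ u p) (∏-distrib-* atV adjU) ⟩
      p * (∏ atV * ∏ adjU)                ≡⟨ cong (p *_) (cong₂ _*_ (∏-if-≟ v p) (∏-if≡^count (λ i → i) (G u) (1ℚ - p))) ⟩
      p * (p * (1ℚ - p) ^ degree G u)     ∎
      where
      open ≡-Reasoning
      atU atV adjU : Fin n → ℚ
      atU i = if ⌊ i ≟ u ⌋ then p else 1ℚ
      atV i = if ⌊ i ≟ v ⌋ then p else 1ℚ
      adjU i = if G u i then 1ℚ - p else 1ℚ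
      factorise : ∀ i → weight (isolating G u v i) ≡ atU i * (atV i * adjU i)
      factorise i = weight-isolationConstraint (G u i) ⌊ i ≟ u ⌋ ⌊ i ≟ v ⌋
        (λ ui i≡u → ¬uu (subst (T ∘ G u) (toWitness i≡u) ui))
        (λ ui i≡v → ¬uv (subst (T ∘ G u) (toWitness i≡v) ui))
        (λ i≡u i≡v → u≢v (trans (sym (toWitness i≡u)) (toWitness i≡v)))

  -- Analysis of the algorithm on a fixed graph

  module _ (G : Graph n) (simple : IsSimple G) where

    open Sampling (1/suc (maxDegree G)) (0≤1/suc (maxDegree G)) (1/suc≤1 (maxDegree G))

    ¬loop : ∀ u → ¬ T (G u u)
    ¬loop u = subst T (proj₂ simple u)

    isolationBound≤Pr-isolating : ∀ {u v} → u ≢ v → ¬ T (G u v) →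
      isolationBound (maxDegree G) ≤ Pr (matches (isolating G u v))
    isolationBound≤Pr-isolating {u} {v} u≢v ¬uv = begin
      p * (p * (½ * ½))                ≤⟨ *-monoˡ-≤ 0≤p (*-monoˡ-≤ 0≤p ¼≤q^degree) ⟩
      p * (p * q ^ degree G u)         ≡⟨ Pr-isolating G u≢v (¬loop u) ¬uv ⟨
      Pr (matches (isolating G u v))   ∎
      where
      open ℚₚ.≤-Reasoning
      Δ = maxDegree G
      p = 1/suc Δ
      q = 1ℚ - p
      0≤p : 0ℚ ≤ p
      0≤p = 0≤1/suc Δ
      ¼≤q^degree : ½ * ½ ≤ q ^ degree G u
      ¼≤q^degree = ℚₚ.≤-trans (¼≤[1-1/suc]^Δ Δ)
        (^-antimonoʳ-≤ (a≤b⇒0≤b-a (1/suc≤1 Δ)) (a-b≤a 0≤p) (degree≤maxDegree G u))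

    Pr-spurious≤ : ∀ t u v → Prˢ {n} {t} (λ Qs → spurious G Qs u v) ≤ (1ℚ - isolationBound (maxDegree G)) ^ t
    Pr-spurious≤ t u v = by-cases (u ≟ v) (T? (G u v))
      where
      β = (1ℚ - isolationBound (maxDegree G)) ^ t
      impossible : ∀ {E : Vec (Subset n) t → Bool} → (∀ Qs → ¬ T (E Qs)) → Prˢ {n} {t} E ≤ β
      impossible never = subst (_≤ β) (sym (mass-impossible (allSeqs n t) (seqWeight (1/suc (maxDegree G))) never))
                               (0≤[1-isolationBound]^ (maxDegree G) t)
      by-cases : Dec (u ≡ v) → Dec (T (G u v)) → Prˢ {n} {t} (λ Qs → spurious G Qs u v) ≤ β
      by-cases (yes u≡v) _ = impossible (λ Qs s → spurious⇒≢ G {Qs} s u≡v)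
      by-cases (no _) (yes uv) = impossible (λ Qs s → spurious⇒nonEdge G {Qs} s uv)
      by-cases (no u≢v) (no ¬uv) = begin
        Prˢ {n} {t} (λ Qs → spurious G Qs u v)
          ≤⟨ mass-mono (allSeqs n t) seqWeight-nonNeg neverIsolated ⟩
        Prˢ {n} {t} (every (not ∘ matches (isolating G u v)))
          ≡⟨ Prˢ-every t (not ∘ matches (isolating G u v)) ⟩
        Pr (not ∘ matches (isolating G u v)) ^ t
          ≤⟨ ^-monoˡ-≤ t (mass-nonNeg (allSubsets n) _ subsetWeight-nonNeg) miss≤ ⟩
        β
          ∎
        where
        open ℚₚ.≤-Reasoning
        neverIsolated : ∀ Qs → T (spurious G Qs u v) → T (every (not ∘ matches (isolating G u v)) Qs)
        neverIsolated Qs = unseparated⇒unisolated G u≢v (¬loop u) ¬uv Qs ∘ spurious⇒unseparated G {Qs}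
        miss≤ : Pr (not ∘ matches (isolating G u v)) ≤ 1ℚ - isolationBound (maxDegree G)
        miss≤ = begin
          Pr (not ∘ matches (isolating G u v))  ≡⟨ mass-not (allSubsets n) (matches (isolating G u v)) (Pr-total n) ⟩
          1ℚ - Pr (matches (isolating G u v))   ≤⟨ 1-x≤1-y (isolationBound≤Pr-isolating u≢v ¬uv) ⟩
          1ℚ - isolationBound (maxDegree G)     ∎

    Pr-spuriousAt≤ : ∀ t u →
      Prˢ {n} {t} (λ Qs → any (spurious G Qs u) (allFin n)) ≤ n × (1ℚ - isolationBound (maxDegree G)) ^ t
    Pr-spuriousAt≤ t u = begin
      Prˢ {n} {t} (λ Qs → any (spurious G Qs u) (allFin n))
        ≤⟨ union-bound (allSeqs n t) (allFin n) (λ v Qs → spurious G Qs u v) seqWeight-nonNeg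
                       (λ Qs → any⁻ (spurious G Qs u) (allFin n)) ⟩
      ∑[ v ∈ allFin n ] Prˢ {n} {t} (λ Qs → spurious G Qs u v)
        ≤⟨ ∑-mono-≤ (allFin n) (Pr-spurious≤ t u) ⟩
      ∑[ v ∈ allFin n ] β
        ≡⟨ ∑-allFin-const n β ⟩
      n × β
        ∎
      where
      open ℚₚ.≤-Reasoning
      β = (1ℚ - isolationBound (maxDegree G)) ^ t

    Pr-failure≤ : ∀ t →
      Prˢ {n} {t} (λ Qs → not (graphEq (output G Qs) G)) ≤ n × (n × (1ℚ - isolationBound (maxDegree G)) ^ t)
    Pr-failure≤ t = begin
      Prˢ {n} {t} (λ Qs → not (graphEq (output G Qs) G))
        ≤⟨ union-bound (allSeqs n t) (allFin n) (λ u Qs → any (spurious G Qs u) (allFin n)) seqWeight-nonNeg cover ⟩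
      ∑[ u ∈ allFin n ] Prˢ {n} {t} (λ Qs → any (spurious G Qs u) (allFin n))
        ≤⟨ ∑-mono-≤ (allFin n) (Pr-spuriousAt≤ t) ⟩
      ∑[ u ∈ allFin n ] (n × β)
        ≡⟨ ∑-allFin-const n (n × β) ⟩
      n × (n × β)
        ∎
      where
      open ℚₚ.≤-Reasoning
      β = (1ℚ - isolationBound (maxDegree G)) ^ t
      cover : ∀ Qs → T (not (graphEq (output G Qs) G)) → Any (λ u → T (any (spurious G Qs u) (allFin n))) (allFin n)
      cover Qs failed with ¬graphEq⇒extraEdge (output G Qs) G (λ u v → edge⇒output G simple Qs) (T-not⇒¬T failed)
      ... | u , v , extra = lose (∈-allFin u) (any⁺ (spurious G Qs u) (lose (∈-allFin v) extra))

    successProb≥ : ∀ t → n × (n × (1ℚ - isolationBound (maxDegree G)) ^ t) ≤ ε →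
      1ℚ - ε ≤ successProb G (maxDegree G) t
    successProb≥ {ε} t failure≤ε = begin
      1ℚ - ε                      ≤⟨ 1-x≤1-y (ℚₚ.≤-trans (Pr-failure≤ t) failure≤ε) ⟩
      1ℚ - Prˢ (not ∘ success)    ≡⟨ cong (λ z → 1ℚ - z) (mass-not (allSeqs n t) success (Prˢ-total n t)) ⟩
      1ℚ - (1ℚ - Prˢ success)     ≡⟨ cancel (Prˢ success) ⟩
      Prˢ success                 ∎
      where
      open ℚₚ.≤-Reasoning
      success : Vec (Subset n) t → Bool
      success Qs = graphEq (output G Qs) G
      cancel : ∀ a → 1ℚ - (1ℚ - a) ≡ a
      cancel = solve-∀ ℚ-ring

open import Data.Nat using (ℕ; _≥_; _*_; _^_; suc)
open import Data.Nat.Logarithm using (⌈log₂_⌉)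
open import Data.Rational using (ℚ; 0ℚ; 1ℚ; _-_; _<_; _≤_)
open import Data.Product using (∃; _,_)

theorem1 : ∃ λ (c : ℕ) → (ε : ℚ) → 0ℚ < ε → ∃ λ (N : ℕ) → (n : ℕ) → n ≥ N →
    (G : Graph n) → IsSimple G →
    1ℚ - ε ≤ successProb G (maxDegree G) (c * (suc (maxDegree G) ^ 2) * ⌈log₂ n ⌉)
theorem1 = 12 , λ ε 0<ε →
  let N , failure≤ε = n²×[1-isolationBound]^t≤ε 0<ε
  in N , λ n N≤n G simple →
    successProb≥ G simple (queries n (maxDegree G)) (failure≤ε (maxDegree G) N≤n)
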